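{- Let $k\ge1$, let $\pi$ be a permutation of $[n]$ and let $f_\pi=\varphi^{ -1}(\pi)$ be the corresponding subexcedant function. Then $\pi(i)\equiv i\pmod k$ for all $i\in[n]$ if and only if $f_\pi(i)\equiv i\pmod k$ for all $i\in[n]$.
   Context: A subexcedant function on $[n]$ is a map $f:[n]\to[n]$ with $1\le f(i)\le i$ for all $i$. The map $\varphi$ sends a subexcedant function $f$ to the permutation $\varphi(f) = (n\ f(n)) \circ \dots \circ (2\ f(2)) \circ (1\ f(1))$, where $(a\ b)$ is the transposition swapping $a$ and $b$ (the identity if $a=b$) and $\circ$ is composition of functions; $\varphi$ is a bijection from subexcedant functions on $[n]$ onto permutations of $[n]$. -}

module Defs where

open import Data.Nat using (ℕ; _≤_; NonZero)
open import Data.Nat.DivMod using (_%_)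
open import Data.Fin using (Fin; toℕ)
open import Data.Fin.Permutation using (Permutation′; id; _∘ₚ_; transpose)
open import Data.List using (foldl; allFin)
open import Data.Product using (Σ; proj₁)
open import Relation.Binary.PropositionalEquality using (_≡_)

-- [n] is represented by Fin n (element i : Fin n stands for toℕ i + 1).
-- The shift by 1 is harmless for the subexcedant condition and for
-- congruences modulo k.

Subexcedant : ℕ → Set
Subexcedant n = Σ (Fin n → Fin n) (λ f → ∀ i → toℕ (f i) ≤ toℕ i)

-- φ(f) = (n f(n)) ∘ ... ∘ (2 f(2)) ∘ (1 f(1)).
-- In stdlib, π₁ ∘ₚ π₂ means "first π₁, then π₂", so we fold over
-- i = 1, 2, ..., n, appending the transposition (i f(i)) to be applied last.
φ : ∀ {n} → Subexcedant n → Permutation′ n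
φ {n} f = foldl (λ acc i → acc ∘ₚ transpose i (proj₁ f i)) id (allFin n)

_≡[mod_]_ : ∀ {n} → Fin n → (k : ℕ) → .{{NonZero k}} → Fin n → Set
a ≡[mod k ] b = toℕ a % k ≡ toℕ b % k

{-# OPTIONS --safe #-}
-- On ℕ, φ(f) is the product of the transpositions (m f(m)) applied for m = 0, 1, …, n − 1,
-- and a transposition of two congruent points preserves residues mod k: one direction.
-- For the converse, peel transpositions off from the top. The earlier ones fix m since f is
-- subexcedant, so the product of the first m + 1 sends m to f(m). If that product preserves
-- residues then f(m) ≡ m, so its last transposition does too, and hence the product of the first m.
module Submission where

open import Defs
open import Data.Nat using (ℕ; NonZero; zero; suc; _<_; _≤_; _≟_; _<?_; _%_; s≤s)
open import Data.Nat.Properties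
  using (≤-refl; ≤-trans; ≤-reflexive; n≤1+n; <-irrefl; ≤-pred; m≤n⇒m<n∨m≡n; ≮⇒≥)
open import Data.Fin using (Fin; toℕ; fromℕ<)
import Data.Fin as Fin
open import Data.Fin.Properties using (toℕ-fromℕ<; fromℕ<-toℕ; toℕ<n; toℕ-injective)
open import Data.Fin.Permutation using (Permutation′; _⟨$⟩ʳ_; _∘ₚ_; transpose; id)
import Data.Fin.Permutation.Components as PC
open import Data.List using (List; []; _∷_; _∷ʳ_; foldl; map; tabulate; applyUpTo; upTo; allFin)
open import Data.List.Properties using (foldl-∷ʳ; upTo-∷ʳ; map-tabulate)
open import Data.Product using (proj₁; proj₂)
open import Data.Sum using ([_,_])
open import Data.Empty using (⊥-elim)
open import Function using (_∘_)
open import Function.Bundles using (_⇔_; mk⇔)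
open import Function.Construct.Symmetry using (⇔-sym)
open import Function.Properties.Equivalence using (⇔-setoid)
open import Level using (0ℓ)
open import Relation.Nullary using (yes; no)
open import Relation.Binary.PropositionalEquality
import Relation.Binary.Reasoning.Setoid as SetoidReasoning

swap : ℕ → ℕ → ℕ → ℕ
swap a b y with y ≟ a
... | yes _ = b
... | no _ with y ≟ b
...   | yes _ = a
...   | no _  = y

swap-fixes : ∀ a b y → y ≢ a → y ≢ b → swap a b y ≡ y
swap-fixes a b y y≢a y≢b with y ≟ a
... | yes y≡a = ⊥-elim (y≢a y≡a)
... | no _ with y ≟ b
...   | yes y≡b = ⊥-elim (y≢b y≡b)
...   | no _    = refl

swap-left : ∀ a b → swap a b a ≡ b
swap-left a b with a ≟ a
... | yes _   = refl
... | no a≢a  = ⊥-elim (a≢a refl)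

swap-right : ∀ a b → swap a b b ≡ a
swap-right a b with b ≟ a
... | yes refl = refl
... | no _ with b ≟ b
...   | yes _   = refl
...   | no b≢b  = ⊥-elim (b≢b refl)

swap-involutive : ∀ a b y → swap a b (swap a b y) ≡ y
swap-involutive a b y with y ≟ a
... | yes refl = swap-right y b
... | no y≢a with y ≟ b
...   | yes refl = swap-left a y
...   | no y≢b   = swap-fixes a b y y≢a y≢b

swap-% : ∀ k .{{_ : NonZero k}} a b y → a % k ≡ b % k → swap a b y % k ≡ y % k
swap-% k a b y a≡b with y ≟ a
... | yes refl = sym a≡b
... | no _ with y ≟ b
...   | yes refl = a≡b
...   | no _     = refl

toℕ-transpose : ∀ {n} (i j y : Fin n) → toℕ (PC.transpose i j y) ≡ swap (toℕ i) (toℕ j) (toℕ y)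
toℕ-transpose i j y with y Fin.≟ i | toℕ y ≟ toℕ i
... | yes _   | yes _   = refl
... | yes y≡i | no y≢i  = ⊥-elim (y≢i (cong toℕ y≡i))
... | no y≢i  | yes y≡i = ⊥-elim (y≢i (toℕ-injective y≡i))
... | no _    | no _ with y Fin.≟ j | toℕ y ≟ toℕ j
...   | yes _   | yes _   = refl
...   | yes y≡j | no y≢j  = ⊥-elim (y≢j (cong toℕ y≡j))
...   | no y≢j  | yes y≡j = ⊥-elim (y≢j (toℕ-injective y≡j))
...   | no _    | no _    = refl

PreservesResidues : (k : ℕ) → .{{NonZero k}} → (ℕ → ℕ) → Set
PreservesResidues k h = ∀ y → h y % k ≡ y % k

-- swaps g m = (m-1 g(m-1)) ∘ ⋯ ∘ (1 g(1)) ∘ (0 g(0)): the map φ on the first m points, indexed from 0.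
swaps : (ℕ → ℕ) → ℕ → ℕ → ℕ
swaps g zero    y = y
swaps g (suc m) y = swap m (g m) (swaps g m y)

swaps-preservesResidues : ∀ k .{{_ : NonZero k}} g m →
  (∀ j → j < m → g j % k ≡ j % k) → PreservesResidues k (swaps g m)
swaps-preservesResidues k g zero    _  y = refl
swaps-preservesResidues k g (suc m) g≡ y =
  trans (swap-% k m (g m) (swaps g m y) (sym (g≡ m ≤-refl)))
        (swaps-preservesResidues k g m (λ j j<m → g≡ j (≤-trans j<m (n≤1+n m))) y)

module _ {g : ℕ → ℕ} (g≤ : ∀ j → g j ≤ j) where

  swaps-fixes : ∀ m y → m ≤ y → swaps g m y ≡ y
  swaps-fixes zero    y _   = refl
  swaps-fixes (suc m) y m<y = begin
    swap m (g m) (swaps g m y) ≡⟨ cong (swap m (g m)) (swaps-fixes m y (≤-trans (n≤1+n m) m<y)) ⟩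
    swap m (g m) y             ≡⟨ swap-fixes m (g m) y (λ y≡m → <-irrefl (sym y≡m) m<y)
                                    (λ y≡gm → <-irrefl (sym y≡gm) (≤-trans (s≤s (g≤ m)) m<y)) ⟩
    y                          ∎
    where open ≡-Reasoning

  swaps-last : ∀ m → swaps g (suc m) m ≡ g m
  swaps-last m = trans (cong (swap m (g m)) (swaps-fixes m m ≤-refl)) (swap-left m (g m))

  module _ (k : ℕ) .{{_ : NonZero k}} where

    preservesResidues-swaps : ∀ m → PreservesResidues k (swaps g m) → ∀ j → j < m → g j % k ≡ j % k
    preservesResidues-swaps (suc m) pres j j<1+m =
      [ preservesResidues-swaps m pres′ j , (λ { refl → gm≡m }) ] (m≤n⇒m<n∨m≡n (≤-pred j<1+m))
      where
      gm≡m : g m % k ≡ m % k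
      gm≡m = trans (cong (_% k) (sym (swaps-last m))) (pres m)

      pres′ : PreservesResidues k (swaps g m)
      pres′ y = begin
        swaps g m y % k                      ≡⟨ cong (_% k) (sym (swap-involutive m (g m) (swaps g m y))) ⟩
        swap m (g m) (swaps g (suc m) y) % k ≡⟨ swap-% k m (g m) _ (sym gm≡m) ⟩
        swaps g (suc m) y % k                ≡⟨ pres y ⟩
        y % k                                ∎
        where open ≡-Reasoning

    swaps-preservesResidues⇔ : ∀ m →
      (∀ y → y < m → swaps g m y % k ≡ y % k) ⇔ (∀ j → j < m → g j % k ≡ j % k)
    swaps-preservesResidues⇔ m = mk⇔
      (λ below → preservesResidues-swaps m (everywhere below))
      (λ g≡ y _ → swaps-preservesResidues k g m g≡ y)
      where
      everywhere : (∀ y → y < m → swaps g m y % k ≡ y % k) → PreservesResidues k (swaps g m)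
      everywhere below y with y <? m
      ... | yes y<m = below y y<m
      ... | no y≮m  = cong (_% k) (swaps-fixes m y (≮⇒≥ y≮m))

-- Extended by the identity outside [0, n), so that the extension of a subexcedant map stays subexcedant.
extend : ∀ {n} → (Fin n → Fin n) → ℕ → ℕ
extend {n} h j with j <? n
... | yes j<n = toℕ (h (fromℕ< j<n))
... | no _    = j

extend-toℕ : ∀ {n} (h : Fin n → Fin n) i → extend h (toℕ i) ≡ toℕ (h i)
extend-toℕ {n} h i with toℕ i <? n
... | yes i<n = cong (toℕ ∘ h) (fromℕ<-toℕ i i<n)
... | no i≮n  = ⊥-elim (i≮n (toℕ<n i))

extend-≤ : ∀ {n} (f : Subexcedant n) j → extend (proj₁ f) j ≤ j
extend-≤ {n} f j with j <? n
... | yes j<n = ≤-trans (proj₂ f (fromℕ< j<n)) (≤-reflexive (toℕ-fromℕ< j<n))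
... | no _    = ≤-refl

toℕ-foldl-transpose : ∀ {n} (h : Fin n → Fin n) (is : List (Fin n)) σ x →
  toℕ (foldl (λ σ i → σ ∘ₚ transpose i (h i)) σ is ⟨$⟩ʳ x)
    ≡ foldl (λ y j → swap j (extend h j) y) (toℕ (σ ⟨$⟩ʳ x)) (map toℕ is)
toℕ-foldl-transpose {n} h []       σ x = refl
toℕ-foldl-transpose {n} h (i ∷ is) σ x = begin
  toℕ (foldl step (step σ i) is ⟨$⟩ʳ x)
    ≡⟨ toℕ-foldl-transpose h is (step σ i) x ⟩
  foldl swapStep (toℕ (PC.transpose i (h i) y)) (map toℕ is)
    ≡⟨ cong (λ z → foldl swapStep z (map toℕ is)) (toℕ-transpose i (h i) y) ⟩
  foldl swapStep (swap (toℕ i) (toℕ (h i)) (toℕ y)) (map toℕ is)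
    ≡⟨ cong (λ z → foldl swapStep (swap (toℕ i) z (toℕ y)) (map toℕ is)) (sym (extend-toℕ h i)) ⟩
  foldl swapStep (swapStep (toℕ y) (toℕ i)) (map toℕ is)
    ∎
  where
  open ≡-Reasoning

  y : Fin n
  y = σ ⟨$⟩ʳ x

  step : Permutation′ n → Fin n → Permutation′ n
  step σ i = σ ∘ₚ transpose i (h i)

  swapStep : ℕ → ℕ → ℕ
  swapStep y j = swap j (extend h j) y

foldl-swap-upTo : ∀ g m y → foldl (λ y j → swap j (g j) y) y (upTo m) ≡ swaps g m y
foldl-swap-upTo g zero    y = refl
foldl-swap-upTo g (suc m) y = begin
  foldl swapStep y (upTo (suc m))        ≡⟨ cong (foldl swapStep y) (sym (upTo-∷ʳ m)) ⟩
  foldl swapStep y (upTo m ∷ʳ m)         ≡⟨ foldl-∷ʳ swapStep y m (upTo m) ⟩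
  swapStep (foldl swapStep y (upTo m)) m ≡⟨ cong (swap m (g m)) (foldl-swap-upTo g m y) ⟩
  swaps g (suc m) y                      ∎
  where
  open ≡-Reasoning

  swapStep : ℕ → ℕ → ℕ
  swapStep y j = swap j (g j) y

tabulate-∘toℕ : ∀ {A : Set} n (g : ℕ → A) → tabulate {n = n} (g ∘ toℕ) ≡ applyUpTo g n
tabulate-∘toℕ zero    g = refl
tabulate-∘toℕ (suc n) g = cong (g 0 ∷_) (tabulate-∘toℕ n (g ∘ suc))

map-toℕ-allFin : ∀ n → map toℕ (allFin n) ≡ upTo n
map-toℕ-allFin n = trans (map-tabulate (λ i → i) toℕ) (tabulate-∘toℕ n (λ j → j))

toℕ-φ : ∀ {n} (f : Subexcedant n) x → toℕ (φ f ⟨$⟩ʳ x) ≡ swaps (extend (proj₁ f)) n (toℕ x)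
toℕ-φ {n} f x = begin
  toℕ (φ f ⟨$⟩ʳ x)                            ≡⟨ toℕ-foldl-transpose (proj₁ f) (allFin n) id x ⟩
  foldl swapStep (toℕ x) (map toℕ (allFin n)) ≡⟨ cong (foldl swapStep (toℕ x)) (map-toℕ-allFin n) ⟩
  foldl swapStep (toℕ x) (upTo n)             ≡⟨ foldl-swap-upTo (extend (proj₁ f)) n (toℕ x) ⟩
  swaps (extend (proj₁ f)) n (toℕ x)          ∎
  where
  open ≡-Reasoning

  swapStep : ℕ → ℕ → ℕ
  swapStep y j = swap j (extend (proj₁ f) j) y

∀Fin⇔∀< : ∀ {n} (P : ℕ → Set) → (∀ (i : Fin n) → P (toℕ i)) ⇔ (∀ j → j < n → P j)
∀Fin⇔∀< P = mk⇔
  (λ ∀P j j<n → subst P (toℕ-fromℕ< j<n) (∀P (fromℕ< j<n)))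
  (λ ∀P i → ∀P (toℕ i) (toℕ<n i))

∀-residues-cong : ∀ {A : Set} k .{{_ : NonZero k}} {a b : A → ℕ} (c : A → ℕ) → (∀ x → a x ≡ b x) →
  (∀ x → a x % k ≡ c x % k) ⇔ (∀ x → b x % k ≡ c x % k)
∀-residues-cong k c a≗b = mk⇔
  (λ ∀a x → trans (cong (_% k) (sym (a≗b x))) (∀a x))
  (λ ∀b x → trans (cong (_% k) (a≗b x)) (∀b x))

mainTheorem8 : (n k : ℕ) → .{{_ : NonZero k}} → (π : Permutation′ n) → (f : Subexcedant n)
    → (∀ i → φ f ⟨$⟩ʳ i ≡ π ⟨$⟩ʳ i)
    → ((∀ (i : Fin n) → (π ⟨$⟩ʳ i) ≡[mod k ] i) ⇔ (∀ (i : Fin n) → proj₁ f i ≡[mod k ] i))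
mainTheorem8 n k π f φf≗π = begin
  (∀ (i : Fin n) → (π ⟨$⟩ʳ i) ≡[mod k ] i)           ≈⟨ ∀-residues-cong k toℕ π≗swaps ⟩
  (∀ (i : Fin n) → swaps g n (toℕ i) % k ≡ toℕ i % k) ≈⟨ ∀Fin⇔∀< (λ y → swaps g n y % k ≡ y % k) ⟩
  (∀ y → y < n → swaps g n y % k ≡ y % k)             ≈⟨ swaps-preservesResidues⇔ (extend-≤ f) k n ⟩
  (∀ j → j < n → g j % k ≡ j % k)                     ≈⟨ ⇔-sym (∀Fin⇔∀< (λ j → g j % k ≡ j % k)) ⟩
  (∀ (i : Fin n) → g (toℕ i) % k ≡ toℕ i % k)         ≈⟨ ∀-residues-cong k toℕ (extend-toℕ (proj₁ f)) ⟩
  (∀ (i : Fin n) → proj₁ f i ≡[mod k ] i)             ∎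
  where
  open SetoidReasoning (⇔-setoid 0ℓ)

  g : ℕ → ℕ
  g = extend (proj₁ f)

  π≗swaps : ∀ i → toℕ (π ⟨$⟩ʳ i) ≡ swaps g n (toℕ i)
  π≗swaps i = trans (cong toℕ (sym (φf≗π i))) (toℕ-φ f i)
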